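{- Let $k$ be an even positive integer. For every integer $n\ge 1$ there exists a cyclic $L_{2k}$-decomposition of $K_{\frac{3k}{2}\times 4n}$.
   Context: The ladder graph $L_{2k}$ is the cartesian product $P_2\times P_k$ of the path on 2 vertices with the path on $k$ vertices. $K_{a\times b}$ denotes the complete $a$-partite graph with $a$ parts each of size $b$. For a graph $\Gamma$, a $\Gamma$-decomposition of a graph $K$ is a set of subgraphs of $K$ each isomorphic to $\Gamma$ whose edge sets partition $E(K)$; it is cyclic if some bijection of $V(K)$ that is a single cycle of length $|V(K)|$ maps the set of blocks onto itself. -}

module Defs where

open import Data.Nat using (ℕ; zero; suc)
open import Data.Fin using (Fin; toℕ)
open import Data.Sum using (_⊎_)
open import Data.Product using (Σ; ∃; ∃-syntax; _×_; _,_)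
open import Relation.Binary.PropositionalEquality using (_≡_; _≢_)
open import Function using (_∘_; _↔_; Inverse; _⇔_)
open import Function.Definitions using (Injective)

iter : {V : Set} → (V → V) → ℕ → V → V
iter f zero x = x
iter f (suc i) x = f (iter f i x)

-- Ladder graph L_{2k} = P_2 □ P_k on vertex set Fin 2 × Fin k
Ladder : ℕ → Set
Ladder k = Fin 2 × Fin k

data LadderAdj {k : ℕ} : Ladder k → Ladder k → Set where
  rung : ∀ {i i' j} → i ≢ i' → LadderAdj (i , j) (i' , j)
  rail : ∀ {i j j'} → (suc (toℕ j) ≡ toℕ j' ⊎ toℕ j ≡ suc (toℕ j')) →
         LadderAdj (i , j) (i , j')

-- Complete multipartite graph K_{a×b}: vertex (p , x) lies in part p;
-- two vertices are adjacent iff they lie in different parts.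
KVertex : ℕ → ℕ → Set
KVertex a b = Fin a × Fin b

KAdj : {a b : ℕ} → KVertex a b → KVertex a b → Set
KAdj (p , _) (q , _) = p ≢ q

BEdge : {V : Set} {k : ℕ} → (Ladder k → V) → V → V → Set
BEdge {k = k} f u v = ∃[ p ] ∃[ q ] (LadderAdj {k} p q × f p ≡ u × f q ≡ v)

IsLadderCopy : {V : Set} (Adj : V → V → Set) (k : ℕ) → (Ladder k → V) → Set
IsLadderCopy Adj k f = Injective _≡_ _≡_ f × (∀ p q → LadderAdj {k} p q → Adj (f p) (f q))

IsLadderDecomposition : {V : Set} (Adj : V → V → Set) (k t : ℕ) → (Fin t → Ladder k → V) → Set
IsLadderDecomposition Adj k t B =
  (∀ j → IsLadderCopy Adj k (B j)) ×
  (∀ u v → Adj u v → ∃[ j ] BEdge (B j) u v) ×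
  (∀ u v j j' → BEdge (B j) u v → BEdge (B j') u v → j ≡ j')

-- σ is a single cycle of length |V| (V finite): one orbit containing everything.
IsFullCycle : {V : Set} → V ↔ V → Set
IsFullCycle σ = ∀ x y → ∃[ i ] iter (Inverse.to σ) i x ≡ y

HasCyclicLadderDecomposition : {V : Set} (Adj : V → V → Set) (k : ℕ) → Set
HasCyclicLadderDecomposition {V} Adj k =
  ∃[ t ] Σ (Fin t → Ladder k → V) λ B →
    IsLadderDecomposition Adj k t B ×
    ∃[ σ ] (IsFullCycle σ ×
      (∀ j → ∃[ j' ] (∀ u v → BEdge (Inverse.to σ ∘ B j) u v ⇔ BEdge (B j') u v)))

module Submission where

-- The proof is the difference method.  Write k = 2h, m = 3h and identify the
-- vertices of K_{m×b} (b = 4n) with ℤ_N, N = b·m, so that two vertices lie in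
-- the same part iff their labels agree mod m; the rotation x ↦ x + 1 is then a
-- single N-cycle.  A family of n "base ladders" labelled in [0, H), H = N/2,
-- is a difference family when, across the family, every δ ∈ [1, H) with
-- m ∤ δ is the label difference of exactly one ladder edge, and no edge joins
-- labels that agree mod m.  Translating every base ladder by every s ∈ ℤ_N
-- then gives a cyclic decomposition (module DifferenceMethod).

open import Defs
open import Data.Nat using (ℕ; _*_; _≥_; _>_; ⌊_/2⌋)
open import Data.Nat.Divisibility using (_∣_)
open import Data.Nat using (zero; suc; _+_; _∸_; _≤_; _<_; z≤n; s≤s; pred; NonZero)
open import Data.Nat.Properties
open import Data.Nat.DivMod
open import Data.Nat.Divisibility using (divides; m∣m*n; m%n≡0⇒n∣m)
open import Data.Nat.Tactic.RingSolver using (solve-∀)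
open import Data.Fin as Fin using (Fin; toℕ; fromℕ<; combine; remQuot; opposite; inject₁)
open import Data.Fin.Patterns using (0F; 1F; 2F)
open import Data.Fin.Properties
  using (toℕ-injective; toℕ<n; toℕ-fromℕ<; toℕ-inject₁; toℕ-combine; combine-injective;
         combine-remQuot; remQuot-combine; opposite-prop; opposite-involutive)
open import Data.Product using (∃-syntax; Σ; _×_; _,_; proj₁; proj₂; swap)
open import Data.Sum using (_⊎_; inj₁; inj₂)
open import Data.Empty using (⊥; ⊥-elim; ⊥-elim-irr)
open import Relation.Nullary using (¬_; yes; no)
open import Relation.Binary.PropositionalEquality
open import Function using (_∘_; id; Inverse; _⇔_; mk⇔)
open import Function.Bundles using (_↔_; mk↔ₛ′)
open import Function.Definitions using (Injective)

+-exchange : ∀ a b c → a + (b + c) ≡ b + (a + c)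
+-exchange a b c = trans (sym (+-assoc a b c)) (trans (cong (_+ c) (+-comm a b)) (+-assoc b a c))

%-absorbˡ : ∀ a b n .{{_ : NonZero n}} → (a % n + b) % n ≡ (a + b) % n
%-absorbˡ a b n = begin
  (a % n + b) % n         ≡⟨ %-distribˡ-+ (a % n) b n ⟩
  (a % n % n + b % n) % n ≡⟨ cong (λ r → (r + b % n) % n) (m%n%n≡m%n a n) ⟩
  (a % n + b % n) % n     ≡⟨ %-distribˡ-+ a b n ⟨
  (a + b) % n             ∎
  where open ≡-Reasoning

%-absorbʳ : ∀ a b n .{{_ : NonZero n}} → (a + b % n) % n ≡ (a + b) % n
%-absorbʳ a b n = begin
  (a + b % n) % n ≡⟨ cong (_% n) (+-comm a (b % n)) ⟩
  (b % n + a) % n ≡⟨ %-absorbˡ b a n ⟩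
  (b + a) % n     ≡⟨ cong (_% n) (+-comm b a) ⟩
  (a + b) % n     ∎
  where open ≡-Reasoning

%-congʳ-+ : ∀ {a a'} b n .{{_ : NonZero n}} → a % n ≡ a' % n → (a + b) % n ≡ (a' + b) % n
%-congʳ-+ {a} {a'} b n eq = begin
  (a + b) % n      ≡⟨ %-absorbˡ a b n ⟨
  (a % n + b) % n  ≡⟨ cong (λ r → (r + b) % n) eq ⟩
  (a' % n + b) % n ≡⟨ %-absorbˡ a' b n ⟩
  (a' + b) % n     ∎
  where open ≡-Reasoning

-- ... and common summands cancel (add (n - 1)·c to both sides).
%-cancelˡ-+ : ∀ c {a a'} n .{{_ : NonZero n}} → (c + a) % n ≡ (c + a') % n → a % n ≡ a' % n
%-cancelˡ-+ c {a} {a'} n eq = begin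
  a % n                      ≡⟨ [m+kn]%n≡m%n a c n ⟨
  (a + c * n) % n            ≡⟨ cong (_% n) (rearrange a) ⟩
  (c + a + (c * n ∸ c)) % n  ≡⟨ %-congʳ-+ (c * n ∸ c) n eq ⟩
  (c + a' + (c * n ∸ c)) % n ≡⟨ cong (_% n) (rearrange a') ⟨
  (a' + c * n) % n           ≡⟨ [m+kn]%n≡m%n a' c n ⟩
  a' % n                     ∎
  where
  open ≡-Reasoning
  rearrange : ∀ x → x + c * n ≡ c + x + (c * n ∸ c)
  rearrange x = begin
    x + c * n             ≡⟨ cong (x +_) (m+[n∸m]≡n (m≤m*n c n)) ⟨
    x + (c + (c * n ∸ c)) ≡⟨ +-assoc x c _ ⟨
    x + c + (c * n ∸ c)   ≡⟨ cong (_+ (c * n ∸ c)) (+-comm x c) ⟩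
    c + x + (c * n ∸ c)   ∎

%-cancelʳ-+ : ∀ c {a a'} n .{{_ : NonZero n}} → (a + c) % n ≡ (a' + c) % n → a % n ≡ a' % n
%-cancelʳ-+ c {a} {a'} n eq =
  %-cancelˡ-+ c n (trans (cong (_% n) (+-comm c a)) (trans eq (cong (_% n) (+-comm a' c))))

residue-shift : ∀ a d n .{{_ : NonZero n}} → a % n ≡ (a + d) % n → d % n ≡ 0
residue-shift a d n eq =
  trans (sym (%-cancelˡ-+ a n (trans (cong (_% n) (+-identityʳ a)) eq))) (m*n%n≡0 0 n)

residue-injective : ∀ {a b} n .{{_ : NonZero n}} → a < n → b < n → a % n ≡ b % n → a ≡ b
residue-injective n a<n b<n eq = trans (sym (m<n⇒m%n≡m a<n)) (trans eq (m<n⇒m%n≡m b<n))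

complement-return : ∀ a d n .{{_ : NonZero n}} → d ≤ n → ((a + d) % n + (n ∸ d)) % n ≡ a % n
complement-return a d n d≤n = begin
  ((a + d) % n + (n ∸ d)) % n ≡⟨ %-absorbˡ (a + d) (n ∸ d) n ⟩
  (a + d + (n ∸ d)) % n       ≡⟨ cong (_% n) (trans (+-assoc a d _) (cong (a +_) (m+[n∸m]≡n d≤n))) ⟩
  (a + n) % n                 ≡⟨ [m+n]%n≡m%n a n ⟩
  a % n                       ∎
  where open ≡-Reasoning

divmod-unique : ∀ d .{{_ : NonZero d}} {q q' r r'} → r < d → r' < d →
                d * q + r ≡ d * q' + r' → q ≡ q' × r ≡ r'
divmod-unique d {q} {q'} {r} {r'} r<d r'<d eq =
  *-cancelˡ-≡ q q' d (+-cancelʳ-≡ r' (d * q) (d * q') (subst (λ x → d * q + x ≡ d * q' + r') r≡r' eq)) ,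
  r≡r'
  where
  r≡r' : r ≡ r'
  r≡r' = residue-injective d r<d r'<d
    (trans (sym (%-remove-+ˡ r (m∣m*n q))) (trans (cong (_% d) eq) (%-remove-+ˡ r' (m∣m*n q'))))

opposite-sum : ∀ {n} (i : Fin n) → suc (toℕ (opposite i) + toℕ i) ≡ n
opposite-sum {n} i = begin
  suc (toℕ (opposite i) + toℕ i) ≡⟨ +-suc (toℕ (opposite i)) (toℕ i) ⟨
  toℕ (opposite i) + suc (toℕ i) ≡⟨ cong (_+ suc (toℕ i)) (opposite-prop i) ⟩
  n ∸ suc (toℕ i) + suc (toℕ i)  ≡⟨ m∸n+n≡m (toℕ<n i) ⟩
  n                              ∎
  where open ≡-Reasoning

opposite-inject₁ : ∀ {n} (i : Fin n) → toℕ (opposite (inject₁ i)) ≡ suc (toℕ (opposite i))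
opposite-inject₁ {n} i = begin
  toℕ (opposite (inject₁ i)) ≡⟨ opposite-prop (inject₁ i) ⟩
  n ∸ toℕ (inject₁ i)        ≡⟨ cong (n ∸_) (toℕ-inject₁ i) ⟩
  suc n ∸ suc (toℕ i)        ≡⟨ +-∸-assoc 1 (toℕ<n i) ⟩
  suc (n ∸ suc (toℕ i))      ≡⟨ cong suc (opposite-prop i) ⟨
  suc (toℕ (opposite i))     ∎
  where open ≡-Reasoning

ladder-sym : ∀ {k} {p q : Ladder k} → LadderAdj p q → LadderAdj q p
ladder-sym (rung i≢i') = rung (i≢i' ∘ sym)
ladder-sym (rail (inj₁ step)) = rail (inj₂ (sym step))
ladder-sym (rail (inj₂ step)) = rail (inj₁ (sym step))

BEdge-sym : ∀ {V : Set} {k} (f : Ladder k → V) {x y : V} → BEdge f x y → BEdge f y x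
BEdge-sym f (p , q , adj , px , qy) = q , p , ladder-sym adj , qy , px

BEdge-ext : ∀ {V : Set} {k} (f f' : Ladder k → V) → (∀ p → f p ≡ f' p) →
            ∀ x y → BEdge f x y ⇔ BEdge f' x y
BEdge-ext f f' f≗f' x y = mk⇔
  (λ (p , q , adj , px , qy) → p , q , adj , trans (sym (f≗f' p)) px , trans (sym (f≗f' q)) qy)
  (λ (p , q , adj , px , qy) → p , q , adj , trans (f≗f' p) px , trans (f≗f' q) qy)

-- The cyclic model of K_{m×b}: vertex (p , x) gets the label m·x + p in [0, N), N = b·m; its part p is the
-- label mod m, and the rotation adds 1 to labels mod N.

module Rotation (m b : ℕ) .{{_ : NonZero m}} .{{_ : NonZero b}} where

  N : ℕ
  N = b * m

  instance
    N-nonZero : NonZero N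
    N-nonZero = m*n≢0 b m

  label : KVertex m b → ℕ
  label (p , x) = toℕ (combine x p)

  vertex : ℕ → KVertex m b
  vertex a = swap (remQuot {b} m (fromℕ< (m%n<n a N)))

  label<N : ∀ v → label v < N
  label<N (p , x) = toℕ<n (combine x p)

  label-injective : ∀ {v v'} → label v ≡ label v' → v ≡ v'
  label-injective {p , x} {p' , x'} eq with refl , refl ← combine-injective x p x' p' (toℕ-injective eq) = refl

  label-vertex : ∀ a → label (vertex a) ≡ a % N
  label-vertex a = trans (cong toℕ (combine-remQuot {b} m _)) (toℕ-fromℕ< (m%n<n a N))

  vertex-label : ∀ v → vertex (label v) ≡ v
  vertex-label v = label-injective (trans (label-vertex (label v)) (m<n⇒m%n≡m (label<N v)))

  vertex-cong : ∀ {a a'} → a % N ≡ a' % N → vertex a ≡ vertex a'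
  vertex-cong {a} {a'} eq = label-injective (trans (label-vertex a) (trans eq (sym (label-vertex a'))))

  vertex-residue : ∀ {a a'} → vertex a ≡ vertex a' → a % N ≡ a' % N
  vertex-residue {a} {a'} eq = trans (sym (label-vertex a)) (trans (cong label eq) (label-vertex a'))

  vertex-+ : ∀ a d → vertex (label (vertex a) + d) ≡ vertex (a + d)
  vertex-+ a d = vertex-cong (trans (cong (λ l → (l + d) % N) (label-vertex a)) (%-absorbˡ a d N))

  vertex-+N : ∀ a → vertex (a + N) ≡ vertex a
  vertex-+N a = vertex-cong ([m+n]%n≡m%n a N)

  part-label : ∀ v → label v % m ≡ toℕ (proj₁ v)
  part-label (p , x) = begin
    toℕ (combine x p) % m   ≡⟨ cong (_% m) (toℕ-combine x p) ⟩
    (m * toℕ x + toℕ p) % m ≡⟨ %-remove-+ˡ (toℕ p) (m∣m*n (toℕ x)) ⟩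
    toℕ p % m               ≡⟨ m<n⇒m%n≡m (toℕ<n p) ⟩
    toℕ p                   ∎
    where open ≡-Reasoning

  part-vertex : ∀ a → toℕ (proj₁ (vertex a)) ≡ a % m
  part-vertex a = begin
    toℕ (proj₁ (vertex a)) ≡⟨ part-label (vertex a) ⟨
    label (vertex a) % m   ≡⟨ cong (_% m) (label-vertex a) ⟩
    a % N % m              ≡⟨ m∣n⇒o%n%m≡o%m m N a (divides b refl) ⟩
    a % m                  ∎
    where open ≡-Reasoning

  same-part : ∀ x y d → (label x + d) % N ≡ label y → d % m ≡ 0 → proj₁ x ≡ proj₁ y
  same-part x y d reach m∣d = toℕ-injective (begin
    toℕ (proj₁ x)           ≡⟨ part-label x ⟨
    label x % m             ≡⟨ %-remove-+ʳ (label x) (m%n≡0⇒n∣m d m m∣d) ⟨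
    (label x + d) % m       ≡⟨ m∣n⇒o%n%m≡o%m m N (label x + d) (divides b refl) ⟨
    (label x + d) % N % m   ≡⟨ cong (_% m) reach ⟩
    label y % m             ≡⟨ part-label y ⟩
    toℕ (proj₁ y)           ∎)
    where open ≡-Reasoning

  forward backward : KVertex m b → KVertex m b
  forward v = vertex (label v + 1)
  backward v = vertex (label v + pred N)

  forward-backward : ∀ v → forward (backward v) ≡ v
  forward-backward v = begin
    vertex (label (vertex (label v + pred N)) + 1) ≡⟨ vertex-+ (label v + pred N) 1 ⟩
    vertex (label v + pred N + 1)                  ≡⟨ cong vertex (trans (+-assoc (label v) (pred N) 1)
                                                        (cong (label v +_) (trans (+-comm (pred N) 1) (suc-pred N)))) ⟩
    vertex (label v + N)                           ≡⟨ vertex-+N (label v) ⟩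
    vertex (label v)                               ≡⟨ vertex-label v ⟩
    v                                              ∎
    where open ≡-Reasoning

  backward-forward : ∀ v → backward (forward v) ≡ v
  backward-forward v = begin
    vertex (label (vertex (label v + 1)) + pred N) ≡⟨ vertex-+ (label v + 1) (pred N) ⟩
    vertex (label v + 1 + pred N)                  ≡⟨ cong vertex (trans (+-assoc (label v) 1 (pred N))
                                                        (cong (label v +_) (suc-pred N))) ⟩
    vertex (label v + N)                           ≡⟨ vertex-+N (label v) ⟩
    vertex (label v)                               ≡⟨ vertex-label v ⟩
    v                                              ∎
    where open ≡-Reasoning

  rotation : KVertex m b ↔ KVertex m b
  rotation = mk↔ₛ′ forward backward forward-backward backward-forward

  iterate-forward : ∀ i v → iter forward i v ≡ vertex (label v + i)
  iterate-forward zero v = trans (sym (vertex-label v)) (cong vertex (sym (+-identityʳ (label v))))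
  iterate-forward (suc i) v = begin
    forward (iter forward i v)                ≡⟨ cong forward (iterate-forward i v) ⟩
    vertex (label (vertex (label v + i)) + 1) ≡⟨ vertex-+ (label v + i) 1 ⟩
    vertex (label v + i + 1)                  ≡⟨ cong vertex (trans (+-assoc (label v) i 1)
                                                   (cong (label v +_) (+-comm i 1))) ⟩
    vertex (label v + suc i)                  ∎
    where open ≡-Reasoning

  -- The rotation is a single cycle: y is reached from x after label y - label x steps.
  rotation-full : IsFullCycle rotation
  rotation-full x y = label y + (N ∸ label x) , (begin
    iter forward (label y + (N ∸ label x)) x     ≡⟨ iterate-forward _ x ⟩
    vertex (label x + (label y + (N ∸ label x))) ≡⟨ cong vertex (+-exchange (label x) (label y) _) ⟩
    vertex (label y + (label x + (N ∸ label x))) ≡⟨ cong (λ d → vertex (label y + d))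
                                                      (m+[n∸m]≡n (<⇒≤ (label<N x))) ⟩
    vertex (label y + N)                         ≡⟨ vertex-+N (label y) ⟩
    vertex (label y)                             ≡⟨ vertex-label y ⟩
    y                                            ∎)
    where open ≡-Reasoning

record IsLadderDifferenceFamily (m H : ℕ) .{{_ : NonZero m}} {c k : ℕ}
                                (L : Fin c → Ladder k → ℕ) : Set where
  field
    bounded   : ∀ i p → L i p < H
    injective : ∀ i → Injective _≡_ _≡_ (L i)
    crossing  : ∀ i p q → LadderAdj p q → L i p % m ≢ L i q % m
    covering  : ∀ δ → δ < H → δ % m ≢ 0 →
                ∃[ i ] ∃[ p ] ∃[ q ] (LadderAdj p q × L i q ≡ L i p + δ)
    unique    : ∀ {i i' p p' q q' δ} → LadderAdj p q → LadderAdj p' q' →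
                L i q ≡ L i p + δ → L i' q' ≡ L i' p' + δ → i ≡ i' × p ≡ p'

module DifferenceMethod
  (m b H : ℕ) .{{_ : NonZero m}} .{{_ : NonZero b}}
  (halves : b * m ≡ H + H) (H-residue : H % m ≡ 0)
  {c k : ℕ} {L : Fin c → Ladder k → ℕ} (family : IsLadderDifferenceFamily m H L)
  where

  open Rotation m b
  open IsLadderDifferenceFamily family

  H≤N : H ≤ N
  H≤N = subst (H ≤_) (sym halves) (m≤m+n H H)

  L<N : ∀ i p → L i p < N
  L<N i p = <-≤-trans (bounded i p) H≤N

  translate : ℕ → Fin c → Ladder k → KVertex m b
  translate s i p = vertex (s + L i p)

  translate-copy : ∀ s i → IsLadderCopy KAdj k (translate s i)
  translate-copy s i = one-to-one , adjacent
    where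
    one-to-one : Injective _≡_ _≡_ (translate s i)
    one-to-one {p} {q} eq =
      injective i (residue-injective N (L<N i p) (L<N i q) (%-cancelˡ-+ s N (vertex-residue eq)))
    adjacent : ∀ p q → LadderAdj p q → KAdj (translate s i p) (translate s i q)
    adjacent p q adj same-part = crossing i p q adj (%-cancelˡ-+ s m (begin
      (s + L i p) % m               ≡⟨ part-vertex (s + L i p) ⟨
      toℕ (proj₁ (translate s i p)) ≡⟨ cong toℕ same-part ⟩
      toℕ (proj₁ (translate s i q)) ≡⟨ part-vertex (s + L i q) ⟩
      (s + L i q) % m               ∎))
      where open ≡-Reasoning

  record Rising (s : ℕ) (i : Fin c) (x y : KVertex m b) (δ : ℕ) : Set where
    field
      {low high} : Ladder k
      adjacent   : LadderAdj low high
      rises      : L i high ≡ L i low + δ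
      low↦x      : translate s i low ≡ x
      high↦y     : translate s i high ≡ y

  orient : ∀ {s i x y} → BEdge (translate s i) x y → ∃[ δ ] (Rising s i x y δ ⊎ Rising s i y x δ)
  orient {i = i} (p , q , adj , px , qy) with ≤-total (L i p) (L i q)
  ... | inj₁ p≤q = L i q ∸ L i p , inj₁ (record
        { adjacent = adj ; rises = sym (m+[n∸m]≡n p≤q) ; low↦x = px ; high↦y = qy })
  ... | inj₂ q≤p = L i p ∸ L i q , inj₂ (record
        { adjacent = ladder-sym adj ; rises = sym (m+[n∸m]≡n q≤p) ; low↦x = qy ; high↦y = px })

  module _ {s i x y δ} (r : Rising s i x y δ) where
    open Rising r

    rising-label : (label x + δ) % N ≡ label y
    rising-label = begin
      (label x + δ) % N                     ≡⟨ cong (λ v → (label v + δ) % N) low↦x ⟨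
      (label (translate s i low) + δ) % N   ≡⟨ cong (λ l → (l + δ) % N) (label-vertex _) ⟩
      ((s + L i low) % N + δ) % N           ≡⟨ %-absorbˡ (s + L i low) δ N ⟩
      (s + L i low + δ) % N                 ≡⟨ cong (_% N) (trans (+-assoc s _ δ) (cong (s +_) (sym rises))) ⟩
      (s + L i high) % N                    ≡⟨ label-vertex _ ⟨
      label (translate s i high)            ≡⟨ cong label high↦y ⟩
      label y                               ∎
      where open ≡-Reasoning

    rising-bounded : δ < H
    rising-bounded = ≤-<-trans (m≤n+m δ (L i low)) (subst (_< H) rises (bounded i high))

    rising-nonzero : δ ≢ 0
    rising-nonzero δ≡0 = crossing i low high adjacent
      (cong (_% m) (sym (trans rises (trans (cong (L i low +_) δ≡0) (+-identityʳ _)))))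

  same-direction : ∀ {s s' i i' x y δ δ'} → s < N → s' < N →
                   Rising s i x y δ → Rising s' i' x y δ' → s ≡ s' × i ≡ i'
  same-direction {s} {s'} {i} {x = x} s<N s'<N r r'
    with refl ← residue-injective N (<-≤-trans (rising-bounded r) H≤N) (<-≤-trans (rising-bounded r') H≤N)
                  (%-cancelˡ-+ (label x) N (trans (rising-label r) (sym (rising-label r'))))
    with refl , same-low ← unique (Rising.adjacent r) (Rising.adjacent r') (Rising.rises r) (Rising.rises r')
    = residue-injective N s<N s'<N (%-cancelʳ-+ (L i (Rising.low r)) N (vertex-residue
        (trans (Rising.low↦x r) (sym (trans (cong (translate s' i) same-low) (Rising.low↦x r')))))) ,
      refl

  -- An edge cannot rise from x to y in one translate and from y to x in another:
  -- the two rises would add up to a multiple of N strictly between 0 and N.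
  opposite-directions : ∀ {s s' i i' x y δ δ'} → Rising s i x y δ → Rising s' i' y x δ' → ⊥
  opposite-directions {x = x} {y} {δ} {δ'} r r' =
    rising-nonzero r (m+n≡0⇒m≡0 δ (residue-injective N sum<N (≤-<-trans z≤n (label<N x))
      (%-cancelˡ-+ (label x) N round-trip)))
    where
    open ≡-Reasoning
    sum<N : δ + δ' < N
    sum<N = subst (δ + δ' <_) (sym halves) (+-mono-< (rising-bounded r) (rising-bounded r'))
    round-trip : (label x + (δ + δ')) % N ≡ (label x + 0) % N
    round-trip = begin
      (label x + (δ + δ')) % N     ≡⟨ cong (_% N) (+-assoc (label x) δ δ') ⟨
      (label x + δ + δ') % N       ≡⟨ %-absorbˡ (label x + δ) δ' N ⟨
      ((label x + δ) % N + δ') % N ≡⟨ cong (λ l → (l + δ') % N) (rising-label r) ⟩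
      (label y + δ') % N           ≡⟨ rising-label r' ⟩
      label x                      ≡⟨ m<n⇒m%n≡m (label<N x) ⟨
      label x % N                  ≡⟨ cong (_% N) (+-identityʳ (label x)) ⟨
      (label x + 0) % N            ∎

  shift : Fin (N * c) → Fin N
  shift j = proj₁ (remQuot {N} c j)

  base : Fin (N * c) → Fin c
  base j = proj₂ (remQuot {N} c j)

  block : Fin (N * c) → Ladder k → KVertex m b
  block j = translate (toℕ (shift j)) (base j)

  same-block : ∀ j j' → toℕ (shift j) ≡ toℕ (shift j') × base j ≡ base j' → j ≡ j'
  same-block j j' (s≡s' , i≡i') = trans (sym (combine-remQuot {N} c j))
    (trans (cong₂ combine (toℕ-injective s≡s') i≡i') (combine-remQuot {N} c j'))

  block-at : ℕ → Fin c → Fin (N * c)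
  block-at s i = combine (fromℕ< (m%n<n s N)) i

  block-at-translate : ∀ s i p → block (block-at s i) p ≡ translate s i p
  block-at-translate s i p = begin
    block (block-at s i) p                    ≡⟨ cong (λ r → translate (toℕ (proj₁ r)) (proj₂ r) p)
                                                   (remQuot-combine {N} {c} (fromℕ< (m%n<n s N)) i) ⟩
    translate (toℕ (fromℕ< (m%n<n s N))) i p  ≡⟨ cong (λ s' → translate s' i p) (toℕ-fromℕ< (m%n<n s N)) ⟩
    vertex (s % N + L i p)                    ≡⟨ vertex-cong (%-absorbˡ s (L i p) N) ⟩
    translate s i p                           ∎
    where open ≡-Reasoning

  block-unique : ∀ x y j j' → BEdge (block j) x y → BEdge (block j') x y → j ≡ j'
  block-unique x y j j' e e' with orient e | orient e'
  ... | _ , inj₁ r | _ , inj₁ r' = same-block j j' (same-direction (toℕ<n (shift j)) (toℕ<n (shift j')) r r')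
  ... | _ , inj₂ r | _ , inj₂ r' = same-block j j' (same-direction (toℕ<n (shift j)) (toℕ<n (shift j')) r r')
  ... | _ , inj₁ r | _ , inj₂ r' = ⊥-elim (opposite-directions r r')
  ... | _ , inj₂ r | _ , inj₁ r' = ⊥-elim (opposite-directions r r')

  -- If y = x + δ in ℤ_N with δ a covered difference, the translate of the base
  -- edge with difference δ that starts at x contains the edge x y.
  cover-rising : ∀ x y δ → (label x + δ) % N ≡ label y → δ < H → δ % m ≢ 0 →
                 ∃[ j ] BEdge (block j) x y
  cover-rising x y δ reach δ<H m∤δ with covering δ δ<H m∤δ
  ... | i , p , q , adj , rises =
    block-at s i , p , q , adj ,
    trans (block-at-translate s i p) low↦x ,
    trans (block-at-translate s i q) high↦y
    where
    open ≡-Reasoning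
    s : ℕ
    s = label x + (N ∸ L i p)
    through-N : s + L i p ≡ label x + N
    through-N = trans (+-assoc (label x) _ (L i p)) (cong (label x +_) (m∸n+n≡m (<⇒≤ (L<N i p))))
    low↦x : translate s i p ≡ x
    low↦x = trans (cong vertex through-N) (trans (vertex-+N (label x)) (vertex-label x))
    high↦y : translate s i q ≡ y
    high↦y = begin
      vertex (s + L i q)             ≡⟨ cong (λ l → vertex (s + l)) rises ⟩
      vertex (s + (L i p + δ))       ≡⟨ cong vertex (trans (sym (+-assoc s _ δ)) (cong (_+ δ) through-N)) ⟩
      vertex (label x + N + δ)       ≡⟨ cong vertex (trans (+-assoc (label x) N δ)
                                          (trans (cong (label x +_) (+-comm N δ)) (sym (+-assoc (label x) δ N)))) ⟩
      vertex (label x + δ + N)       ≡⟨ vertex-+N (label x + δ) ⟩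
      vertex (label x + δ)           ≡⟨ vertex-cong (trans reach (sym (m<n⇒m%n≡m (label<N y)))) ⟩
      vertex (label y)               ≡⟨ vertex-label y ⟩
      y                              ∎

  gap : KVertex m b → KVertex m b → ℕ
  gap x y = (label y + (N ∸ label x)) % N

  gap-reach : ∀ x y → (label x + gap x y) % N ≡ label y
  gap-reach x y = begin
    (label x + gap x y) % N                   ≡⟨ %-absorbʳ (label x) _ N ⟩
    (label x + (label y + (N ∸ label x))) % N ≡⟨ cong (_% N) (+-exchange (label x) (label y) _) ⟩
    (label y + (label x + (N ∸ label x))) % N ≡⟨ cong (λ d → (label y + d) % N)
                                                   (m+[n∸m]≡n (<⇒≤ (label<N x))) ⟩
    (label y + N) % N                         ≡⟨ [m+n]%n≡m%n (label y) N ⟩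
    label y % N                               ≡⟨ m<n⇒m%n≡m (label<N y) ⟩
    label y                                   ∎
    where open ≡-Reasoning

  gap-back : ∀ x y → (label y + (N ∸ gap x y)) % N ≡ label x
  gap-back x y = trans (cong (λ l → (l + (N ∸ gap x y)) % N) (sym (gap-reach x y)))
    (trans (complement-return (label x) (gap x y) N (<⇒≤ (m%n<n _ N))) (m<n⇒m%n≡m (label<N x)))

  -- Between vertices of different parts the gap is never H (as m ∣ H), so if
  -- it is not below H then the backward gap is.
  back-gap-small : ∀ x y → KAdj x y → ¬ (gap x y < H) → N ∸ gap x y < H
  back-gap-small x y x≁y gap≮H = subst (N ∸ gap x y <_) (trans (cong (_∸ H) halves) (m+n∸n≡m H H))
    (∸-monoʳ-< H<gap (<⇒≤ (m%n<n _ N)))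
    where
    H<gap : H < gap x y
    H<gap with m≤n⇒m<n∨m≡n (≮⇒≥ gap≮H)
    ... | inj₁ H<gap = H<gap
    ... | inj₂ H≡gap = ⊥-elim (x≁y (same-part x y (gap x y) (gap-reach x y)
                                     (trans (cong (_% m) (sym H≡gap)) H-residue)))

  cover : ∀ x y → KAdj x y → ∃[ j ] BEdge (block j) x y
  cover x y x≁y with gap x y <? H
  ... | yes gap<H = cover-rising x y (gap x y) (gap-reach x y) gap<H
                      (λ m∣gap → x≁y (same-part x y (gap x y) (gap-reach x y) m∣gap))
  ... | no gap≮H = reverse (cover-rising y x (N ∸ gap x y) (gap-back x y) (back-gap-small x y x≁y gap≮H)
                      (λ m∣back → x≁y (sym (same-part y x (N ∸ gap x y) (gap-back x y) m∣back))))
    where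
    reverse : ∃[ j ] BEdge (block j) y x → ∃[ j ] BEdge (block j) x y
    reverse (j , e) = j , BEdge-sym (block j) e

  cyclic : ∀ j → ∃[ j' ] (∀ x y → BEdge (Inverse.to rotation ∘ block j) x y ⇔ BEdge (block j') x y)
  cyclic j = block-at (suc s) i , BEdge-ext (forward ∘ block j) (block (block-at (suc s) i)) rotate
    where
    s : ℕ
    s = toℕ (shift j)
    i : Fin c
    i = base j
    rotate : ∀ p → forward (translate s i p) ≡ block (block-at (suc s) i) p
    rotate p = trans (vertex-+ (s + L i p) 1)
      (trans (cong vertex (+-comm (s + L i p) 1)) (sym (block-at-translate (suc s) i p)))

  decomposition : HasCyclicLadderDecomposition (KAdj {m} {b}) k
  decomposition =
    N * c , block ,
    ((λ j → translate-copy (toℕ (shift j)) (base j)) , cover , block-unique) ,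
    rotation , rotation-full , cyclic

-- Column j is written 2t + β (pair t < h, parity β).  In base ladder i the
-- vertex (β , 2t + β) is small with label 2t + β, and (1 - β , 2t + β) is
-- large with label m(2i + β) + 2h + (h - 1 - t).  Every edge joins a small and
-- a large vertex, and the edges are listed by codes (u , w , e) with
-- (w , e) ≠ (0 , 0): the edge with code (u , w , e) has difference
-- m(2i + u) + 3w + e, so the codes of the c ladders realise every difference
-- in [0, 2cm) that is not a multiple of m exactly once.

module LadderFamily (g c : ℕ) where

  h k m H : ℕ
  h = suc g
  k = h * 2
  m = h * 3
  H = c * 2 * m

  col : Fin h → Fin 2 → Fin k
  col = combine

  data Column : Fin k → Set where
    column : (t : Fin h) (β : Fin 2) → Column (col t β)

  columnView : ∀ j → Column j
  columnView j = subst Column (combine-remQuot {h} 2 j)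
                   (column (proj₁ (remQuot {h} 2 j)) (proj₂ (remQuot {h} 2 j)))

  within-step : ∀ t → suc (toℕ (col t 0F)) ≡ toℕ (col t 1F)
  within-step t = begin
    suc (toℕ (col t 0F)) ≡⟨ cong suc (toℕ-combine t 0F) ⟩
    suc (2 * toℕ t + 0)  ≡⟨ +-suc (2 * toℕ t) 0 ⟨
    2 * toℕ t + 1        ≡⟨ toℕ-combine t 1F ⟨
    toℕ (col t 1F)       ∎
    where open ≡-Reasoning

  across-step : ∀ (s : Fin g) → suc (toℕ (col (inject₁ s) 1F)) ≡ toℕ (col (Fin.suc s) 0F)
  across-step s = begin
    suc (toℕ (col (inject₁ s) 1F))     ≡⟨ cong suc (toℕ-combine (inject₁ s) 1F) ⟩
    suc (2 * toℕ (inject₁ s) + 1)      ≡⟨ cong (λ n → suc (2 * n + 1)) (toℕ-inject₁ s) ⟩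
    suc (2 * toℕ s + 1)                ≡⟨ arith (toℕ s) ⟩
    2 + (2 * toℕ s + 0)                ≡⟨ cong (2 +_) (toℕ-combine s 0F) ⟨
    toℕ (col (Fin.suc s) 0F)           ∎
    where
    open ≡-Reasoning
    arith : ∀ n → suc (2 * n + 1) ≡ 2 + (2 * n + 0)
    arith = solve-∀

  data Successor : Fin k → Fin k → Set where
    within : (t : Fin h) → Successor (col t 0F) (col t 1F)
    across : (s : Fin g) → Successor (col (inject₁ s) 1F) (col (Fin.suc s) 0F)

  successor : ∀ j j' → suc (toℕ j) ≡ toℕ j' → Successor j j'
  successor j j' step with columnView j'
  ... | column t 1F = subst (λ i → Successor i (col t 1F))
                        (toℕ-injective (suc-injective (trans (within-step t) (sym step)))) (within t)
  ... | column Fin.zero 0F = ⊥-elim (1+n≢0 step)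
  ... | column (Fin.suc s) 0F = subst (λ i → Successor i (col (Fin.suc s) 0F))
                                  (toℕ-injective (suc-injective (trans (across-step s) (sym step)))) (across s)

  small : Fin h → Fin 2 → ℕ
  small t β = toℕ (col t β)

  small-expand : ∀ t β → small t β ≡ 2 * toℕ t + toℕ β
  small-expand t β = toℕ-combine t β

  large : Fin c → Fin 2 → Fin h → ℕ
  large i u t = m * toℕ (combine i u) + (2 * h + toℕ (opposite t))

  labelAt : Fin c → Fin 2 → Fin h → Fin 2 → ℕ
  labelAt i 0F t 0F = small t 0F
  labelAt i 0F t 1F = large i 1F t
  labelAt i 1F t 0F = large i 0F t
  labelAt i 1F t 1F = small t 1F

  L : Fin c → Ladder k → ℕ
  L i (r , j) = labelAt i r (proj₁ (remQuot {h} 2 j)) (proj₂ (remQuot {h} 2 j))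

  L-column : ∀ i r t β → L i (r , col t β) ≡ labelAt i r t β
  L-column i r t β = cong (λ tβ → labelAt i r (proj₁ tβ) (proj₂ tβ)) (remQuot-combine t β)

  labelAt-cases : ∀ i r t β → (r ≡ β × labelAt i r t β ≡ small t β) ⊎
                              (r ≢ β × labelAt i r t β ≡ large i β t)
  labelAt-cases i 0F t 0F = inj₁ (refl , refl)
  labelAt-cases i 0F t 1F = inj₂ ((λ ()) , refl)
  labelAt-cases i 1F t 0F = inj₂ ((λ ()) , refl)
  labelAt-cases i 1F t 1F = inj₁ (refl , refl)

  -- Code (u , w , e) is valid when 3w + e ≠ 0; its low end is
  -- small and its high end is large of family u, in column pair h - 1 - w
  -- (for e = 0 the edge joins the pairs h - 1 - w and h - w).
  R : Fin h → Fin 3 → ℕ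
  R w e = toℕ (combine w e)

  R-expand : ∀ w e → R w e ≡ 3 * toℕ w + toℕ e
  R-expand w e = toℕ-combine w e

  Valid : Fin h → Fin 3 → Set
  Valid w e = R w e ≢ 0

  low high : Fin 2 → (w : Fin h) (e : Fin 3) → .(Valid w e) → Ladder k
  low _ w 1F _ = 1F , col (opposite w) 1F
  low _ w 2F _ = 0F , col (opposite w) 0F
  low _ Fin.zero 0F v = ⊥-elim-irr (v refl)
  low 0F (Fin.suc w₀) 0F _ = 1F , col (inject₁ (opposite w₀)) 1F
  low 1F (Fin.suc w₀) 0F _ = 0F , col (Fin.suc (opposite w₀)) 0F

  high 0F w 1F _ = 1F , col (opposite w) 0F
  high 0F w 2F _ = 1F , col (opposite w) 0F
  high 1F w 1F _ = 0F , col (opposite w) 1F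
  high 1F w 2F _ = 0F , col (opposite w) 1F
  high _ Fin.zero 0F v = ⊥-elim-irr (v refl)
  high 0F (Fin.suc w₀) 0F _ = 1F , col (Fin.suc (opposite w₀)) 0F
  high 1F (Fin.suc w₀) 0F _ = 0F , col (inject₁ (opposite w₀)) 1F

  valid-suc : ∀ w e → Valid w (Fin.suc e)
  valid-suc w e zero-code =
    1+n≢0 (trans (sym (+-suc (3 * toℕ w) (toℕ e))) (trans (sym (R-expand w (Fin.suc e))) zero-code))

  table-adjacent : ∀ u w e .(v : Valid w e) → LadderAdj (low u w e v) (high u w e v)
  table-adjacent 0F w 1F _ = rail (inj₂ (sym (within-step (opposite w))))
  table-adjacent 0F w 2F _ = rung (λ ())
  table-adjacent 1F w 1F _ = rung (λ ())
  table-adjacent 1F w 2F _ = rail (inj₁ (within-step (opposite w)))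
  table-adjacent _ Fin.zero 0F v = ⊥-elim-irr (v refl)
  table-adjacent 0F (Fin.suc w₀) 0F _ = rail (inj₁ (across-step (opposite w₀)))
  table-adjacent 1F (Fin.suc w₀) 0F _ = rail (inj₂ (sym (across-step (opposite w₀))))

  D : Fin c → Fin 2 → Fin h → Fin 3 → ℕ
  D i u w e = toℕ (combine (combine i u) (combine w e))

  D-expand : ∀ i u w e → D i u w e ≡ m * toℕ (combine i u) + R w e
  D-expand i u w e = toℕ-combine (combine i u) (combine w e)

  D-residue : ∀ i u w e → D i u w e % m ≡ R w e
  D-residue i u w e = trans (cong (_% m) (D-expand i u w e))
    (trans (%-remove-+ˡ _ (m∣m*n (toℕ (combine i u)))) (m<n⇒m%n≡m (toℕ<n (combine w e))))

  D-nonzero : ∀ i u w e → Valid w e → D i u w e ≢ 0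
  D-nonzero i u w e v D≡0 = v (trans (sym (D-residue i u w e)) (trans (cong (_% m) D≡0) (m*n%n≡0 0 m)))

  D-injective : ∀ i u w e i' u' w' e' → D i u w e ≡ D i' u' w' e' →
                i ≡ i' × u ≡ u' × w ≡ w' × e ≡ e'
  D-injective i u w e i' u' w' e' eq
    with iu≡ , we≡ ← combine-injective (combine i u) (combine w e) (combine i' u') (combine w' e') (toℕ-injective eq)
    with refl , refl ← combine-injective i u i' u' iu≡
    with refl , refl ← combine-injective w e w' e' we≡
    = refl , refl , refl , refl

  decode : ∀ δ → δ < H → ∃[ i ] ∃[ u ] ∃[ w ] ∃[ e ] D i u w e ≡ δ
  decode δ δ<H = proj₁ iu , proj₂ iu , proj₁ we , proj₂ we , (begin
    toℕ (combine (combine (proj₁ iu) (proj₂ iu)) (combine (proj₁ we) (proj₂ we)))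
      ≡⟨ cong toℕ (cong₂ combine (combine-remQuot {c} 2 (proj₁ qr)) (combine-remQuot {h} 3 (proj₂ qr))) ⟩
    toℕ (combine (proj₁ qr) (proj₂ qr)) ≡⟨ cong toℕ (combine-remQuot {c * 2} m F) ⟩
    toℕ F                               ≡⟨ toℕ-fromℕ< δ<H ⟩
    δ                                   ∎)
    where
    open ≡-Reasoning
    F : Fin H
    F = fromℕ< δ<H
    qr : Fin (c * 2) × Fin m
    qr = remQuot m F
    iu : Fin c × Fin 2
    iu = remQuot 2 (proj₁ qr)
    we : Fin h × Fin 3
    we = remQuot 3 (proj₂ qr)

  rise-from-offset : ∀ i u w e (p q : Ladder k) {offset low-label : ℕ} →
                     L i q ≡ m * toℕ (combine i u) + offset → L i p ≡ low-label →
                     offset ≡ low-label + R w e → L i q ≡ L i p + D i u w e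
  rise-from-offset i u w e p q {offset} {low-label} Lq Lp offset≡ = begin
    L i q                                       ≡⟨ Lq ⟩
    m * toℕ (combine i u) + offset              ≡⟨ cong (m * toℕ (combine i u) +_) offset≡ ⟩
    m * toℕ (combine i u) + (low-label + R w e) ≡⟨ +-exchange (m * toℕ (combine i u)) low-label (R w e) ⟩
    low-label + (m * toℕ (combine i u) + R w e) ≡⟨ cong₂ _+_ (sym Lp) (sym (D-expand i u w e)) ⟩
    L i p + D i u w e                           ∎
    where open ≡-Reasoning

  -- The four offset identities, using t + w = h - 1 for t = opposite w.
  pair-offset : ∀ (w : Fin h) →
                2 * h + toℕ (opposite (opposite w)) ≡ 2 * suc (toℕ (opposite w) + toℕ w) + toℕ w
  pair-offset w = cong₂ (λ n x → 2 * n + x) (sym (opposite-sum w)) (cong toℕ (opposite-involutive w))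

  offset-within₁ : ∀ w → 2 * h + toℕ (opposite (opposite w)) ≡ small (opposite w) 1F + R w 1F
  offset-within₁ w = begin
    2 * h + toℕ (opposite (opposite w)) ≡⟨ pair-offset w ⟩
    2 * suc (T + W) + W                 ≡⟨ arith T W ⟩
    (2 * T + 1) + (3 * W + 1)           ≡⟨ cong₂ _+_ (small-expand (opposite w) 1F) (R-expand w 1F) ⟨
    small (opposite w) 1F + R w 1F ∎
    where
    open ≡-Reasoning
    T W : ℕ
    T = toℕ (opposite w)
    W = toℕ w
    arith : ∀ T W → 2 * suc (T + W) + W ≡ (2 * T + 1) + (3 * W + 1)
    arith = solve-∀

  offset-within₂ : ∀ w → 2 * h + toℕ (opposite (opposite w)) ≡ small (opposite w) 0F + R w 2F
  offset-within₂ w = begin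
    2 * h + toℕ (opposite (opposite w)) ≡⟨ pair-offset w ⟩
    2 * suc (T + W) + W                 ≡⟨ arith T W ⟩
    (2 * T + 0) + (3 * W + 2)           ≡⟨ cong₂ _+_ (small-expand (opposite w) 0F) (R-expand w 2F) ⟨
    small (opposite w) 0F + R w 2F ∎
    where
    open ≡-Reasoning
    T W : ℕ
    T = toℕ (opposite w)
    W = toℕ w
    arith : ∀ T W → 2 * suc (T + W) + W ≡ (2 * T + 0) + (3 * W + 2)
    arith = solve-∀

  offset-across₀ : ∀ (w₀ : Fin g) → 2 * h + toℕ (opposite {h} (Fin.suc (opposite w₀))) ≡
                   small (inject₁ (opposite w₀)) 1F + R (Fin.suc w₀) 0F
  offset-across₀ w₀ = begin
    2 * h + toℕ (inject₁ (opposite (opposite w₀)))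
      ≡⟨ cong₂ (λ n x → 2 * suc n + x) (sym (opposite-sum w₀))
               (trans (toℕ-inject₁ (opposite (opposite w₀))) (cong toℕ (opposite-involutive w₀))) ⟩
    2 * suc (suc (S + W)) + W ≡⟨ arith S W ⟩
    (2 * S + 1) + (3 + (3 * W + 0))
      ≡⟨ cong₂ _+_ (trans (small-expand (inject₁ (opposite w₀)) 1F)
                          (cong (λ n → 2 * n + 1) (toℕ-inject₁ (opposite w₀))))
                   (cong (3 +_) (toℕ-combine {n = 3} w₀ 0F)) ⟨
    small (inject₁ (opposite w₀)) 1F + R (Fin.suc w₀) 0F ∎
    where
    open ≡-Reasoning
    S W : ℕ
    S = toℕ (opposite w₀)
    W = toℕ w₀
    arith : ∀ S W → 2 * suc (suc (S + W)) + W ≡ (2 * S + 1) + (3 + (3 * W + 0))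
    arith = solve-∀

  offset-across₁ : ∀ (w₀ : Fin g) → 2 * h + toℕ (opposite (inject₁ (opposite w₀))) ≡
                   small (Fin.suc (opposite w₀)) 0F + R (Fin.suc w₀) 0F
  offset-across₁ w₀ = begin
    2 * h + toℕ (opposite (inject₁ (opposite w₀)))
      ≡⟨ cong₂ (λ n x → 2 * suc n + x) (sym (opposite-sum w₀))
               (trans (opposite-inject₁ (opposite w₀)) (cong (suc ∘ toℕ) (opposite-involutive w₀))) ⟩
    2 * suc (suc (S + W)) + suc W ≡⟨ arith S W ⟩
    (2 + (2 * S + 0)) + (3 + (3 * W + 0))
      ≡⟨ cong₂ _+_ (cong (2 +_) (toℕ-combine {n = 2} (opposite w₀) 0F))
                   (cong (3 +_) (toℕ-combine {n = 3} w₀ 0F)) ⟨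
    small (Fin.suc (opposite w₀)) 0F + R (Fin.suc w₀) 0F ∎
    where
    open ≡-Reasoning
    S W : ℕ
    S = toℕ (opposite w₀)
    W = toℕ w₀
    arith : ∀ S W → 2 * suc (suc (S + W)) + suc W ≡ (2 + (2 * S + 0)) + (3 + (3 * W + 0))
    arith = solve-∀

  edge-difference : ∀ i u w e .(v : Valid w e) → L i (high u w e v) ≡ L i (low u w e v) + D i u w e
  edge-difference i 0F w 1F v = rise-from-offset i 0F w 1F (low 0F w 1F v) (high 0F w 1F v)
      (L-column i 1F (opposite w) 0F) (L-column i 1F (opposite w) 1F) (offset-within₁ w)
  edge-difference i 0F w 2F v = rise-from-offset i 0F w 2F (low 0F w 2F v) (high 0F w 2F v)
      (L-column i 1F (opposite w) 0F) (L-column i 0F (opposite w) 0F) (offset-within₂ w)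
  edge-difference i 1F w 1F v = rise-from-offset i 1F w 1F (low 1F w 1F v) (high 1F w 1F v)
      (L-column i 0F (opposite w) 1F) (L-column i 1F (opposite w) 1F) (offset-within₁ w)
  edge-difference i 1F w 2F v = rise-from-offset i 1F w 2F (low 1F w 2F v) (high 1F w 2F v)
      (L-column i 0F (opposite w) 1F) (L-column i 0F (opposite w) 0F) (offset-within₂ w)
  edge-difference i _ Fin.zero 0F v = ⊥-elim-irr (v refl)
  edge-difference i 0F (Fin.suc w₀) 0F v =
    rise-from-offset i 0F (Fin.suc w₀) 0F (low 0F (Fin.suc w₀) 0F v) (high 0F (Fin.suc w₀) 0F v)
      (L-column i 1F (Fin.suc (opposite w₀)) 0F) (L-column i 1F (inject₁ (opposite w₀)) 1F) (offset-across₀ w₀)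
  edge-difference i 1F (Fin.suc w₀) 0F v =
    rise-from-offset i 1F (Fin.suc w₀) 0F (low 1F (Fin.suc w₀) 0F v) (high 1F (Fin.suc w₀) 0F v)
      (L-column i 0F (inject₁ (opposite w₀)) 1F) (L-column i 0F (Fin.suc (opposite w₀)) 0F) (offset-across₁ w₀)

  record Tabulated (p q : Ladder k) : Set where
    constructor tabulated
    field
      u : Fin 2
      w : Fin h
      e : Fin 3
      valid : Valid w e
      orientation : (low u w e valid ≡ p × high u w e valid ≡ q) ⊎
                    (high u w e valid ≡ p × low u w e valid ≡ q)

  reverse-tabulated : ∀ {p q} → Tabulated p q → Tabulated q p
  reverse-tabulated (tabulated u w e v (inj₁ (lp , hq))) = tabulated u w e v (inj₂ (hq , lp))
  reverse-tabulated (tabulated u w e v (inj₂ (hp , lq))) = tabulated u w e v (inj₁ (lq , hp))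

  -- Table positions are stated through opposite (opposite t) = t.
  placed : ∀ {n} (r β : Fin 2) (f : Fin n → Fin h) t → (r , col (f (opposite (opposite t))) β) ≡ (r , col (f t) β)
  placed r β f t = cong (λ x → r , col (f x) β) (opposite-involutive t)

  rung-tabulated : ∀ j → Tabulated (0F , j) (1F , j)
  rung-tabulated j with columnView j
  ... | column t 0F = tabulated 0F (opposite t) 2F (valid-suc (opposite t) 1F) (inj₁ (placed 0F 0F id t , placed 1F 0F id t))
  ... | column t 1F = tabulated 1F (opposite t) 1F (valid-suc (opposite t) 0F) (inj₂ (placed 0F 1F id t , placed 1F 1F id t))

  rail-tabulated : ∀ r j j' → suc (toℕ j) ≡ toℕ j' → Tabulated (r , j) (r , j')
  rail-tabulated r j j' step with r | successor j j' step
  ... | 0F | within t = tabulated 1F (opposite t) 2F (valid-suc (opposite t) 1F)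
                          (inj₁ (placed 0F 0F id t , placed 0F 1F id t))
  ... | 0F | across s = tabulated 1F (Fin.suc (opposite s)) 0F (λ ())
                          (inj₂ (placed 0F 1F inject₁ s , placed 0F 0F Fin.suc s))
  ... | 1F | within t = tabulated 0F (opposite t) 1F (valid-suc (opposite t) 0F)
                          (inj₂ (placed 1F 0F id t , placed 1F 1F id t))
  ... | 1F | across s = tabulated 0F (Fin.suc (opposite s)) 0F (λ ())
                          (inj₁ (placed 1F 1F inject₁ s , placed 1F 0F Fin.suc s))

  classify : ∀ p q → LadderAdj p q → Tabulated p q
  classify _ _ (rung {0F} {0F} 0≢0) = ⊥-elim (0≢0 refl)
  classify _ _ (rung {0F} {1F} {j} _) = rung-tabulated j
  classify _ _ (rung {1F} {0F} {j} _) = reverse-tabulated (rung-tabulated j)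
  classify _ _ (rung {1F} {1F} 1≢1) = ⊥-elim (1≢1 refl)
  classify _ _ (rail {r} {j} {j'} (inj₁ step)) = rail-tabulated r j j' step
  classify _ _ (rail {r} {j} {j'} (inj₂ step)) = reverse-tabulated (rail-tabulated r j' j (sym step))

  tabulated-rise : ∀ i {p q} (T : Tabulated p q) → let open Tabulated T in
                   L i q ≡ L i p + D i u w e ⊎ L i p ≡ L i q + D i u w e
  tabulated-rise i (tabulated u w e v (inj₁ (refl , refl))) = inj₁ (edge-difference i u w e v)
  tabulated-rise i (tabulated u w e v (inj₂ (refl , refl))) = inj₂ (edge-difference i u w e v)

  small<m : ∀ t β → small t β < m
  small<m t β = <-≤-trans (toℕ<n (col t β)) (*-monoʳ-≤ h (s≤s (s≤s (z≤n {1}))))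

  large-offset<m : ∀ t → 2 * h + toℕ (opposite t) < m
  large-offset<m t = <-≤-trans (+-monoʳ-< (2 * h) (toℕ<n (opposite t))) (≤-reflexive (arith h))
    where
    arith : ∀ h → 2 * h + h ≡ h * 3
    arith = solve-∀

  slice-bound : ∀ (Q : Fin (c * 2)) a → a < m → m * toℕ Q + a < H
  slice-bound Q a a<m = begin-strict
    m * toℕ Q + a   <⟨ +-monoʳ-< (m * toℕ Q) a<m ⟩
    m * toℕ Q + m   ≡⟨ +-comm (m * toℕ Q) m ⟩
    m + m * toℕ Q   ≡⟨ *-suc m (toℕ Q) ⟨
    m * suc (toℕ Q) ≤⟨ *-monoʳ-≤ m (toℕ<n Q) ⟩
    m * (c * 2)     ≡⟨ *-comm m (c * 2) ⟩
    H               ∎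
    where open ≤-Reasoning

  labelAt-bound : ∀ i r t β → labelAt i r t β < H
  labelAt-bound i r t β with labelAt-cases i r t β
  ... | inj₁ (_ , is-small) = subst (_< H) (sym is-small)
          (≤-<-trans (m≤n+m (small t β) _) (slice-bound (combine i β) (small t β) (small<m t β)))
  ... | inj₂ (_ , is-large) = subst (_< H) (sym is-large) (slice-bound (combine i β) _ (large-offset<m t))

  bounded : ∀ i p → L i p < H
  bounded i (r , j) with columnView j
  ... | column t β = subst (_< H) (sym (L-column i r t β)) (labelAt-bound i r t β)

  -- Injectivity: small labels are column indices, large labels determine family
  -- and pair by division by m, and small labels stay below every large one.
  small-injective : ∀ t β t' β' → small t β ≡ small t' β' → t ≡ t' × β ≡ β'
  small-injective t β t' β' eq = combine-injective t β t' β' (toℕ-injective eq)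

  large-injective : ∀ i u t u' t' → large i u t ≡ large i u' t' → u ≡ u' × t ≡ t'
  large-injective i u t u' t' eq
    with Q≡ , offset≡ ← divmod-unique m (large-offset<m t) (large-offset<m t') eq =
    proj₂ (combine-injective i u i u' (toℕ-injective Q≡)) ,
    trans (sym (opposite-involutive t))
      (trans (cong opposite (toℕ-injective (+-cancelˡ-≡ (2 * h) _ _ offset≡))) (opposite-involutive t'))

  small<large : ∀ i u t t' β → small t β < large i u t'
  small<large i u t t' β = <-≤-trans (toℕ<n (col t β)) (begin
    h * 2                     ≡⟨ *-comm h 2 ⟩
    2 * h                     ≤⟨ m≤m+n (2 * h) (toℕ (opposite t')) ⟩
    2 * h + toℕ (opposite t') ≤⟨ m≤n+m _ (m * toℕ (combine i u)) ⟩
    large i u t'              ∎)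
    where open ≤-Reasoning

  other-row : ∀ {r r' β : Fin 2} → r ≢ β → r' ≢ β → r ≡ r'
  other-row {0F} {0F} _ _ = refl
  other-row {1F} {1F} _ _ = refl
  other-row {0F} {1F} {0F} r≢β _ = ⊥-elim (r≢β refl)
  other-row {0F} {1F} {1F} _ r'≢β = ⊥-elim (r'≢β refl)
  other-row {1F} {0F} {0F} _ r'≢β = ⊥-elim (r'≢β refl)
  other-row {1F} {0F} {1F} r≢β _ = ⊥-elim (r≢β refl)

  labelAt-injective : ∀ i r t β r' t' β' → labelAt i r t β ≡ labelAt i r' t' β' →
                      (r , col t β) ≡ (r' , col t' β')
  labelAt-injective i r t β r' t' β' eq with labelAt-cases i r t β | labelAt-cases i r' t' β'
  ... | inj₁ (r≡β , l) | inj₁ (r'≡β' , l')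
    with refl , refl ← small-injective t β t' β' (trans (sym l) (trans eq l'))
    = cong (_, col t β) (trans r≡β (sym r'≡β'))
  ... | inj₁ (_ , l) | inj₂ (_ , l') = ⊥-elim (<⇒≢ (small<large i β' t t' β) (trans (sym l) (trans eq l')))
  ... | inj₂ (_ , l) | inj₁ (_ , l') = ⊥-elim (<⇒≢ (small<large i β t' t β') (trans (sym l') (trans (sym eq) l)))
  ... | inj₂ (r≢β , l) | inj₂ (r'≢β' , l')
    with refl , refl ← large-injective i β t β' t' (trans (sym l) (trans eq l'))
    = cong (_, col t β) (other-row r≢β r'≢β')

  injective : ∀ i → Injective _≡_ _≡_ (L i)
  injective i {r , j} {r' , j'} eq with columnView j | columnView j'
  ... | column t β | column t' β' =
    labelAt-injective i r t β r' t' β' (trans (sym (L-column i r t β)) (trans eq (L-column i r' t' β')))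

  -- Adjacent labels differ by some D i u w e, which is not a multiple of m.
  crossing : ∀ i p q → LadderAdj p q → L i p % m ≢ L i q % m
  crossing i p q adj = cross (classify p q adj)
    where
    cross : Tabulated p q → L i p % m ≢ L i q % m
    cross T@(tabulated u w e v _) same with tabulated-rise i T
    ... | inj₁ rise = v (trans (sym (D-residue i u w e))
                           (residue-shift (L i p) _ m (trans same (cong (_% m) rise))))
    ... | inj₂ rise = v (trans (sym (D-residue i u w e))
                           (residue-shift (L i q) _ m (trans (sym same) (cong (_% m) rise))))

  covering : ∀ δ → δ < H → δ % m ≢ 0 → ∃[ i ] ∃[ p ] ∃[ q ] (LadderAdj p q × L i q ≡ L i p + δ)
  covering δ δ<H m∤δ with i , u , w , e , D≡δ ← decode δ δ<H =
    i , low u w e v , high u w e v , table-adjacent u w e v ,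
    trans (edge-difference i u w e v) (cong (L i (low u w e v) +_) D≡δ)
    where
    v : Valid w e
    v R≡0 = m∤δ (trans (cong (_% m) (sym D≡δ)) (trans (D-residue i u w e) R≡0))

  -- An edge whose labels rise by δ is the table edge of the code with difference δ
  -- (the other direction would make D i u w e + δ = 0).
  rising-code : ∀ {i p q δ} → LadderAdj p q → L i q ≡ L i p + δ →
                ∃[ u ] ∃[ w ] ∃[ e ] Σ (Valid w e) λ v → low u w e v ≡ p × D i u w e ≡ δ
  rising-code {i} {p} {q} {δ} adj rises with classify p q adj
  ... | tabulated u w e v (inj₁ (refl , refl)) =
    u , w , e , v , refl , +-cancelˡ-≡ (L i p) _ _ (trans (sym (edge-difference i u w e v)) rises)
  ... | tabulated u w e v (inj₂ (refl , refl)) =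
    ⊥-elim (D-nonzero i u w e v (m+n≡0⇒m≡0 (D i u w e) (+-cancelˡ-≡ (L i q) _ 0 (begin
      L i q + (D i u w e + δ) ≡⟨ +-assoc (L i q) _ δ ⟨
      L i q + D i u w e + δ   ≡⟨ cong (_+ δ) (edge-difference i u w e v) ⟨
      L i p + δ               ≡⟨ rises ⟨
      L i q                   ≡⟨ +-identityʳ (L i q) ⟨
      L i q + 0               ∎))))
    where open ≡-Reasoning

  unique : ∀ {i i' p p' q q' δ} → LadderAdj p q → LadderAdj p' q' →
           L i q ≡ L i p + δ → L i' q' ≡ L i' p' + δ → i ≡ i' × p ≡ p'
  unique {i} {i'} adj adj' rises rises'
    with u , w , e , v , refl , D≡δ ← rising-code {i} adj rises
       | u' , w' , e' , v' , refl , D'≡δ ← rising-code {i'} adj' rises'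
    with refl , refl , refl , refl ← D-injective i u w e i' u' w' e' (trans D≡δ (sym D'≡δ))
    = refl , refl

  family : IsLadderDifferenceFamily m H L
  family = record
    { bounded = bounded ; injective = injective ; crossing = crossing
    ; covering = covering ; unique = unique }

ladder-decomposition : ∀ g c₀ → HasCyclicLadderDecomposition (KAdj {suc g * 3} {4 * suc c₀}) (suc g * 2)
ladder-decomposition g c₀ =
  DifferenceMethod.decomposition (suc g * 3) (4 * suc c₀) (suc c₀ * 2 * (suc g * 3))
    (halves (suc g) (suc c₀)) (m*n%n≡0 (suc c₀ * 2) (suc g * 3)) (LadderFamily.family g (suc c₀))
  where
  halves : ∀ h c → 4 * c * (h * 3) ≡ c * 2 * (h * 3) + c * 2 * (h * 3)
  halves = solve-∀

parts-of-even : ∀ h → h * 3 ≡ ⌊ 3 * (h * 2) /2⌋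
parts-of-even h = trans (n≡⌊n+n/2⌋ (h * 3)) (cong ⌊_/2⌋ (arith h))
  where
  arith : ∀ h → h * 3 + h * 3 ≡ 3 * (h * 2)
  arith = solve-∀

proposition4p6 : (k : ℕ) → k > 0 → 2 ∣ k → (n : ℕ) → n ≥ 1 →
                 HasCyclicLadderDecomposition (KAdj {⌊ 3 * k /2⌋} {4 * n}) k
proposition4p6 .(suc g * 2) _ (divides (suc g) refl) (suc c₀) _ =
  subst (λ parts → HasCyclicLadderDecomposition (KAdj {parts} {4 * suc c₀}) (suc g * 2))
        (parts-of-even (suc g)) (ladder-decomposition g c₀)
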